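{- Suppose $(d,p)=1$. Then there is a $d$-th root $f^{1/d}\in k_\infty$ of $f$.
   Context: $q$ is a power of a prime $p$, $A=\mathbb F_q[T]$, $k_\infty=\mathbb F_q((1/T))$. Let $a\in A$ be monic of degree $d\ge1$, $b\in\mathbb F_q^\times$, and $f\in k_\infty$ the root of $X^2-aX-b$ with $|f|=|a|=q^d$ (absolute value normalized by $|T|=q$). -}

module Defs where

open import Level using (0ℓ)
open import Algebra.Bundles using (CommutativeRing)
open import Data.Nat as ℕ using (ℕ; zero; suc; _^_)
open import Data.Nat.Primality using (Prime)
open import Data.Integer as ℤ using (ℤ; +_; -[1+_]; _⊓_)
open import Data.Fin using (Fin)
open import Data.Vec using (Vec; []; _∷_)
open import Data.Product using (Σ; ∃; _×_)
open import Function.Bundles using (Inverse)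
open import Relation.Binary.PropositionalEquality as ≡ using (_≡_)
open import Relation.Nullary using (¬_)

record FiniteField (q p : ℕ) : Set₁ where
  field
    ring       : CommutativeRing 0ℓ 0ℓ
  open CommutativeRing ring
  field
    nontrivial : ¬ (0# ≈ 1#)
    inv        : ∀ x → ¬ (x ≈ 0#) → Σ Carrier (λ y → x * y ≈ 1#)
    enum       : Inverse setoid (≡.setoid (Fin q))
    p-prime    : Prime p
    q-power    : Σ ℕ (λ m → (1 ℕ.≤ m) × (q ≡ p ^ m))

-- Laurent series in x = 1/T over a commutative ring, i.e. k_∞ = F((1/T)).
module Laurent (R : CommutativeRing 0ℓ 0ℓ) where
  open CommutativeRing R hiding (zero)

  -- (e , s) represents  Σ_{i ≥ 0} s i · x^(e + i),  x = 1/T = T^(-1)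
  record Lau : Set where
    constructor lau
    field
      shift : ℤ
      coeffs : ℕ → Carrier

  -- coefficient of x^k  (= coefficient of T^(-k))
  coeff : Lau → ℤ → Carrier
  coeff (lau e s) k = go (k ℤ.- e)
    where
    go : ℤ → Carrier
    go (+ n)    = s n
    go -[1+ n ] = 0#

  infix 4 _≈L_
  _≈L_ : Lau → Lau → Set
  u ≈L v = ∀ k → coeff u k ≈ coeff v k

  sumTo : (ℕ → Carrier) → ℕ → Carrier
  sumTo f zero    = f zero
  sumTo f (suc n) = sumTo f n + f (suc n)

  infixl 6 _+L_
  infixl 7 _*L_
  _+L_ : Lau → Lau → Lau
  u +L v = lau m (λ n → coeff u (m ℤ.+ + n) + coeff v (m ℤ.+ + n))
    where m = Lau.shift u ⊓ Lau.shift v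

  _*L_ : Lau → Lau → Lau
  lau e s *L lau e' s' =
    lau (e ℤ.+ e') (λ n → sumTo (λ i → s i * s' (n ℕ.∸ i)) n)

  monoX : Carrier → ℤ → Lau
  monoX c e = lau e λ { zero → c ; (suc _) → 0# }

  const : Carrier → Lau
  const c = monoX c (+ 0)

  0L 1L : Lau
  0L = const 0#
  1L = const 1#

  monoT : Carrier → ℕ → Lau
  monoT c j = monoX c (ℤ.- (+ j))

  _^L_ : Lau → ℕ → Lau
  u ^L zero  = 1L
  u ^L suc n = u *L (u ^L n)

  polySum : ∀ {n} → ℕ → Vec Carrier n → Lau
  polySum j []       = 0L
  polySum j (c ∷ cs) = monoT c j +L polySum (suc j) cs

  -- the monic polynomial T^d + a_{d-1} T^{d-1} + ... + a_0 of A = F[T],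
  -- given by its lower coefficients (a_0 , ... , a_{d-1}), as element of k_∞
  monic : (d : ℕ) → Vec Carrier d → Lau
  monic d as = monoT 1# d +L polySum 0 as

  -- |u| = q^n  (normalised |T| = q): the lowest nonzero coefficient
  -- of u in x = 1/T is at x^(-n).
  HasAbs : Lau → ℤ → Set
  HasAbs u n = ¬ (coeff u (ℤ.- n) ≈ 0#)
             × (∀ k → k ℤ.< ℤ.- n → coeff u k ≈ 0#)

-- Comparing the coefficients of T^(2d) in f² = a f + b shows that the leading coefficient of f
-- is idempotent, hence 1, so f = T^d u with u a power series in 1/T with constant term 1. As d is
-- prime to p and q · 1 = 0 in F, d is a unit of F. The coefficients of a d-th root c of u can then
-- be found one at a time, because the N-th coefficient of c^d is d c_N plus a polynomial in
-- c_0, …, c_(N-1).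
module Submission where

open import Defs
open import Data.Nat using (ℕ; _≤_)
open import Data.Nat.Coprimality using (Coprime)
open import Data.Integer using (+_)
open import Data.Vec using (Vec)
open import Data.Product using (Σ)
open import Relation.Nullary using (¬_)
open import Algebra.Bundles using (CommutativeRing)

open import Level using (0ℓ)
open import Algebra.Bundles using (Monoid; AbelianGroup; Group; Semiring)
open import Data.Nat as ℕ using (zero; suc; z≤n; s≤s; _<_; _∸_; _^_)
import Data.Nat.Properties as ℕP
open import Data.Nat.Divisibility using (∣1⇒≡1; ∣-trans)
open import Data.Nat.Coprimality using (coprime-divisor; coprime-Bézout)
open import Data.Nat.GCD using (module Bézout)
open import Data.Integer as ℤ using (ℤ; -[1+_]; _⊓_; +<+; -<+)
import Data.Integer.Properties as ℤP
open import Data.Integer.Tactic.RingSolver using (solve-∀)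
open import Data.Fin using (Fin)
open import Data.Fin.Permutation using (Permutation′; permutation)
open import Data.Vec using ([]; _∷_)
open import Data.Vec.Functional using (replicate)
open import Data.Product using (_,_; proj₁; proj₂)
open import Function using (_∘_)
open import Function.Bundles using (Inverse)
open import Relation.Binary.Definitions using (tri<; tri≈; tri>)
open import Relation.Binary.PropositionalEquality as ≡ using (_≡_; _≢_)
open import Relation.Nullary using (yes; no)
open import Relation.Nullary.Negation using (contradiction)

coprime-^ : ∀ {d p} m → Coprime d p → Coprime d (p ^ m)
coprime-^ zero c (_ , i∣1) = ∣1⇒≡1 i∣1
coprime-^ (suc m) c (i∣d , i∣p^[1+m]) =
  coprime-^ m c (i∣d , coprime-divisor (λ (j∣i , j∣p) → c (∣-trans j∣i i∣d , j∣p)) i∣p^[1+m])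

module _ {c ℓ} (M : Monoid c ℓ) where
  open Monoid M
  open import Relation.Binary.Reasoning.Setoid setoid

  idempotent∧invertible⇒≈ε : ∀ {x y} → x ∙ x ≈ x → x ∙ y ≈ ε → x ≈ ε
  idempotent∧invertible⇒≈ε {x} {y} xx≈x xy≈ε = begin
    x              ≈⟨ identityʳ x ⟨
    x ∙ ε          ≈⟨ ∙-congˡ xy≈ε ⟨
    x ∙ (x ∙ y)    ≈⟨ assoc x x y ⟨
    x ∙ x ∙ y      ≈⟨ ∙-congʳ xx≈x ⟩
    x ∙ y          ≈⟨ xy≈ε ⟩
    ε              ∎

module FiniteAbelianGroup (G : AbelianGroup 0ℓ 0ℓ) {q : ℕ}
                          (enum : Inverse (AbelianGroup.setoid G) (≡.setoid (Fin q))) where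
  open AbelianGroup G
  open Group group using (_\\_)
  open import Algebra.Properties.Group group using (identityˡ-unique; \\-leftDividesˡ; \\-leftDividesʳ)
  open import Algebra.Properties.Monoid.Mult monoid using (_×_)
  open import Algebra.Properties.CommutativeMonoid.Sum commutativeMonoid
    using (sum; sum-cong-≋; sum-permute; ∑-distrib-+; sum-replicate)
  open Inverse enum using (to; from) renaming (inverseˡ to to-inverse; inverseʳ to from-inverse)
  open import Relation.Binary.Reasoning.Setoid setoid

  from-to : ∀ x → from (to x) ≈ x
  from-to x = from-inverse ≡.refl

  -- Translation by x permutes the elements, so it fixes their sum S, while adding q × x to it.
  ×-order : ∀ x → q × x ≈ ε
  ×-order x = identityˡ-unique (q × x) S (sym (begin
    S                                   ≈⟨ sum-permute from translation ⟩
    sum (λ i → from (to (x ∙ from i)))  ≈⟨ sum-cong-≋ (λ i → from-to (x ∙ from i)) ⟩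
    sum (λ i → x ∙ from i)              ≈⟨ ∑-distrib-+ (replicate q x) from ⟩
    sum (replicate q x) ∙ S             ≈⟨ ∙-congʳ (sum-replicate q) ⟩
    q × x ∙ S                           ∎))
    where
    S : Carrier
    S = sum from
    translation : Permutation′ q
    translation = permutation (λ i → to (x ∙ from i)) (λ i → to (x \\ from i))
      (λ i → to-inverse (trans (∙-cong refl (from-to _)) (\\-leftDividesˡ x (from i))))
      (λ i → to-inverse (trans (∙-cong refl (from-to _)) (\\-leftDividesʳ x (from i))))

module _ {c ℓ} (S : Semiring c ℓ) where
  open Semiring S
  open import Algebra.Properties.Semiring.Mult S using (_×_; ×1-homo-*)
  open import Relation.Binary.Reasoning.Setoid setoid

  private
    ×1≈0⇒multiple : ∀ a {m} → m × 1# ≈ 0# → (a ℕ.* m) × 1# ≈ 0#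
    ×1≈0⇒multiple a {m} m×1≈0 = trans (×1-homo-* a m) (trans (*-congˡ m×1≈0) (zeroʳ _))

    Bézout⇒1≈0 : ∀ a b m n → 1 ℕ.+ a ℕ.* m ≡ b ℕ.* n →
                 m × 1# ≈ 0# → n × 1# ≈ 0# → 1# ≈ 0#
    Bézout⇒1≈0 a b m n eq m×1≈0 n×1≈0 = begin
      1#                      ≈⟨ +-identityʳ 1# ⟨
      1# + 0#                 ≈⟨ +-congˡ (×1≈0⇒multiple a m×1≈0) ⟨
      (1 ℕ.+ a ℕ.* m) × 1#    ≡⟨ ≡.cong (_× 1#) eq ⟩
      (b ℕ.* n) × 1#          ≈⟨ ×1≈0⇒multiple b n×1≈0 ⟩
      0#                      ∎

  coprime-×1≈0⇒1≈0 : ∀ {m n} → Coprime m n → m × 1# ≈ 0# → n × 1# ≈ 0# → 1# ≈ 0#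
  coprime-×1≈0⇒1≈0 {m} {n} c m×1≈0 n×1≈0 with coprime-Bézout c
  ... | Bézout.+- x y eq = Bézout⇒1≈0 y x n m eq n×1≈0 m×1≈0
  ... | Bézout.-+ x y eq = Bézout⇒1≈0 x y m n eq m×1≈0 n×1≈0

module _ {q p : ℕ} (F : FiniteField q p) where
  open FiniteField F
  open CommutativeRing ring
  open import Algebra.Properties.Semiring.Mult semiring using (_×_)
  open FiniteAbelianGroup +-abelianGroup enum using (×-order)

  ×1-invertible : ∀ {d} → Coprime d p → Σ Carrier (λ y → d × 1# * y ≈ 1#)
  ×1-invertible {d} d⊥p = inv (d × 1#) λ d×1≈0 →
    nontrivial (sym (coprime-×1≈0⇒1≈0 semiring d⊥q d×1≈0 (×-order 1#)))
    where
    d⊥q : Coprime d q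
    d⊥q with q-power
    ... | m , _ , q≡p^m = ≡.subst (Coprime d) (≡.sym q≡p^m) (coprime-^ m d⊥p)

private
  e+[k-e]≡k : ∀ e k → e ℤ.+ (k ℤ.- e) ≡ k
  e+[k-e]≡k = solve-∀

  -≡⇒+≡ : ∀ {e k j} → k ℤ.- e ≡ j → e ℤ.+ j ≡ k
  -≡⇒+≡ {e} {k} eq = ≡.trans (≡.cong (λ z → e ℤ.+ z) (≡.sym eq)) (e+[k-e]≡k e k)

  [e+k]-e≡k : ∀ e k → (e ℤ.+ k) ℤ.- e ≡ k
  [e+k]-e≡k = solve-∀

  e+k<e : ∀ e n → e ℤ.+ -[1+ n ] ℤ.< e
  e+k<e e n = ≡.subst (e ℤ.+ -[1+ n ] ℤ.<_) (ℤP.+-identityʳ e) (ℤP.+-monoʳ-< e -<+)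

  regroup : ∀ e e′ i j → (e ℤ.+ + i) ℤ.+ (e′ ℤ.+ + j) ≡ e ℤ.+ e′ ℤ.+ + (i ℕ.+ j)
  regroup e e′ i j = ≡.trans (lemma e e′ (+ i) (+ j)) (≡.cong (λ z → e ℤ.+ e′ ℤ.+ z) (≡.sym (ℤP.pos-+ i j)))
    where
    lemma : ∀ e e′ i j → (e ℤ.+ i) ℤ.+ (e′ ℤ.+ j) ≡ e ℤ.+ e′ ℤ.+ (i ℤ.+ j)
    lemma = solve-∀

  +-<⇒< : ∀ {x y a b} → x ℤ.+ y ℤ.< a ℤ.+ b → a ℤ.≤ x → y ℤ.< b
  +-<⇒< {y = y} {b = b} x+y<a+b a≤x with y ℤP.<? b
  ... | yes y<b = y<b
  ... | no y≮b = contradiction x+y<a+b (ℤP.≤⇒≯ (ℤP.+-mono-≤ a≤x (ℤP.≮⇒≥ y≮b)))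

data Position (e : ℤ) : ℤ → Set where
  below : ∀ {k} → k ℤ.< e → Position e k
  at    : ∀ n → Position e (e ℤ.+ + n)

position : ∀ e k → Position e k
position e k with k ℤ.- e in eq
... | + n      = ≡.subst (Position e) (-≡⇒+≡ eq) (at n)
... | -[1+ n ] = below (≡.subst (ℤ._< e) (-≡⇒+≡ eq) (e+k<e e n))

module SumTo (R : CommutativeRing 0ℓ 0ℓ) where
  open CommutativeRing R hiding (zero)
  open Laurent R using (sumTo)
  open import Algebra.Properties.CommutativeSemigroup +-commutativeSemigroup using (xy∙z≈xz∙y)
  open import Relation.Binary.Reasoning.Setoid setoid

  sumTo-cong : ∀ n {t t′ : ℕ → Carrier} → (∀ i → i ≤ n → t i ≈ t′ i) → sumTo t n ≈ sumTo t′ n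
  sumTo-cong zero    t≈t′ = t≈t′ 0 z≤n
  sumTo-cong (suc n) t≈t′ = +-cong (sumTo-cong n (λ i i≤n → t≈t′ i (ℕP.m≤n⇒m≤1+n i≤n))) (t≈t′ (suc n) ℕP.≤-refl)

  sumTo-zero : ∀ n {t : ℕ → Carrier} → (∀ i → i ≤ n → t i ≈ 0#) → sumTo t n ≈ 0#
  sumTo-zero zero    t≈0 = t≈0 0 z≤n
  sumTo-zero (suc n) t≈0 = trans (+-cong (sumTo-zero n (λ i i≤n → t≈0 i (ℕP.m≤n⇒m≤1+n i≤n))) (t≈0 (suc n) ℕP.≤-refl))
                                 (+-identityˡ 0#)

  sumTo-single : ∀ n {j} {t : ℕ → Carrier} → j ≤ n → (∀ i → i ≤ n → i ≢ j → t i ≈ 0#) → sumTo t n ≈ t j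
  sumTo-single zero z≤n _ = refl
  sumTo-single (suc n) {j} j≤1+n t≈0 with j ℕP.≟ suc n
  ... | yes ≡.refl = trans (+-congʳ (sumTo-zero n (λ i i≤n → t≈0 i (ℕP.m≤n⇒m≤1+n i≤n) (ℕP.<⇒≢ (s≤s i≤n)))))
                           (+-identityˡ _)
  ... | no j≢1+n = trans (+-cong (sumTo-single n (ℕP.≤-pred (ℕP.≤∧≢⇒< j≤1+n j≢1+n))
                                                 (λ i i≤n → t≈0 i (ℕP.m≤n⇒m≤1+n i≤n)))
                                 (t≈0 (suc n) ℕP.≤-refl (j≢1+n ∘ ≡.sym)))
                         (+-identityʳ _)

  sumTo-shift-head : ∀ n {t t′ : ℕ → Carrier} x → t 0 ≈ t′ 0 + x → (∀ i → 1 ≤ i → i ≤ n → t i ≈ t′ i) →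
                     sumTo t n ≈ sumTo t′ n + x
  sumTo-shift-head zero    x t₀≈ _ = t₀≈
  sumTo-shift-head (suc n) {t} {t′} x t₀≈ t≈t′ = begin
    sumTo t n + t (suc n)           ≈⟨ +-cong (sumTo-shift-head n x t₀≈ (λ i 1≤i i≤n → t≈t′ i 1≤i (ℕP.m≤n⇒m≤1+n i≤n)))
                                              (t≈t′ (suc n) (s≤s z≤n) ℕP.≤-refl) ⟩
    sumTo t′ n + x + t′ (suc n)     ≈⟨ xy∙z≈xz∙y _ x _ ⟩
    sumTo t′ n + t′ (suc n) + x     ∎

module LaurentCoefficients (R : CommutativeRing 0ℓ 0ℓ) where
  open CommutativeRing R hiding (zero)
  open Laurent R
  open SumTo R using (sumTo-zero; sumTo-single)
  open import Relation.Binary.Reasoning.Setoid setoid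

  coeff-shift-+ : ∀ u n → coeff u (Lau.shift u ℤ.+ + n) ≡ Lau.coeffs u n
  coeff-shift-+ (lau e s) n rewrite [e+k]-e≡k e (+ n) = ≡.refl

  coeff-<-shift : ∀ u {k} → k ℤ.< Lau.shift u → coeff u k ≡ 0#
  coeff-<-shift (lau e s) {k} k<e with k ℤ.- e in eq
  ... | -[1+ _ ] = ≡.refl
  ... | + n = contradiction k<e (ℤP.≤⇒≯ (≡.subst (e ℤ.≤_) (-≡⇒+≡ eq) (ℤP.i≤i+j e (+ n))))

  coeff-+L : ∀ u v k → coeff (u +L v) k ≈ coeff u k + coeff v k
  coeff-+L u@(lau e s) v@(lau e′ s′) k with position (e ⊓ e′) k
  ... | at n = reflexive (coeff-shift-+ (u +L v) n)
  ... | below k<e⊓e′ = begin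
    coeff (u +L v) k    ≡⟨ coeff-<-shift (u +L v) k<e⊓e′ ⟩
    0#                  ≈⟨ +-identityʳ 0# ⟨
    0# + 0#             ≡⟨ ≡.cong₂ _+_ (coeff-<-shift u (ℤP.<-≤-trans k<e⊓e′ (ℤP.i⊓j≤i e e′)))
                                       (coeff-<-shift v (ℤP.<-≤-trans k<e⊓e′ (ℤP.i⊓j≤j e e′))) ⟨
    coeff u k + coeff v k ∎

  coeff-monoX-≡ : ∀ c e → coeff (monoX c e) e ≡ c
  coeff-monoX-≡ c e = ≡.subst (λ k → coeff (monoX c e) k ≡ c) (ℤP.+-identityʳ e) (coeff-shift-+ (monoX c e) 0)

  coeff-monoX-≢ : ∀ c {e k} → k ≢ e → coeff (monoX c e) k ≡ 0#
  coeff-monoX-≢ c {e} {k} k≢e with position e k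
  ... | below k<e = coeff-<-shift (monoX c e) k<e
  ... | at zero = contradiction (ℤP.+-identityʳ e) k≢e
  ... | at (suc n) = coeff-shift-+ (monoX c e) (suc n)

  coeff-0L : ∀ k → coeff 0L k ≡ 0#
  coeff-0L k with position (+ 0) k
  ... | below k<0 = coeff-<-shift 0L k<0
  ... | at zero = coeff-shift-+ 0L zero
  ... | at (suc n) = coeff-shift-+ 0L (suc n)

  coeff-polySum : ∀ j {n} (cs : Vec Carrier n) {k} → k ℤ.≤ ℤ.- + (j ℕ.+ n) →
                  coeff (polySum j cs) k ≈ 0#
  coeff-polySum j [] {k} _ = reflexive (coeff-0L k)
  coeff-polySum j {suc n} (c ∷ cs) {k} k≤ = begin
    coeff (monoT c j +L polySum (suc j) cs) k             ≈⟨ coeff-+L (monoT c j) (polySum (suc j) cs) k ⟩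
    coeff (monoT c j) k + coeff (polySum (suc j) cs) k    ≈⟨ +-cong (reflexive (coeff-monoX-≢ c (ℤP.<⇒≢ k<-j)))
                                                                    (coeff-polySum (suc j) cs k≤′) ⟩
    0# + 0#                                               ≈⟨ +-identityʳ 0# ⟩
    0#                                                    ∎
    where
    k<-j : k ℤ.< ℤ.- + j
    k<-j = ℤP.≤-<-trans k≤ (ℤP.neg-mono-< (+<+ (ℕP.m<m+n j (s≤s z≤n))))
    k≤′ : k ℤ.≤ ℤ.- + (suc j ℕ.+ n)
    k≤′ = ≡.subst (λ m → k ℤ.≤ ℤ.- + m) (ℕP.+-suc j n) k≤

  coeff-monic-< : ∀ d (as : Vec Carrier d) {k} → k ℤ.< ℤ.- + d → coeff (monic d as) k ≈ 0#
  coeff-monic-< d as {k} k<-d = begin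
    coeff (monoT 1# d +L polySum 0 as) k           ≈⟨ coeff-+L (monoT 1# d) (polySum 0 as) k ⟩
    coeff (monoT 1# d) k + coeff (polySum 0 as) k  ≈⟨ +-cong (reflexive (coeff-monoX-≢ 1# (ℤP.<⇒≢ k<-d)))
                                                             (coeff-polySum 0 as (ℤP.<⇒≤ k<-d)) ⟩
    0# + 0#                                        ≈⟨ +-identityʳ 0# ⟩
    0#                                             ∎

  coeff-monic-leading : ∀ d (as : Vec Carrier d) → coeff (monic d as) (ℤ.- + d) ≈ 1#
  coeff-monic-leading d as = begin
    coeff (monoT 1# d +L polySum 0 as) (ℤ.- + d)                  ≈⟨ coeff-+L (monoT 1# d) (polySum 0 as) (ℤ.- + d) ⟩
    coeff (monoT 1# d) (ℤ.- + d) + coeff (polySum 0 as) (ℤ.- + d) ≈⟨ +-cong (reflexive (coeff-monoX-≡ 1# (ℤ.- + d)))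
                                                                            (coeff-polySum 0 as ℤP.≤-refl) ⟩
    1# + 0#                                                       ≈⟨ +-identityʳ 1# ⟩
    1#                                                            ∎

  coeff-*L-< : ∀ u v {A B k} → (∀ k → k ℤ.< A → coeff u k ≈ 0#) → (∀ k → k ℤ.< B → coeff v k ≈ 0#) →
               k ℤ.< A ℤ.+ B → coeff (u *L v) k ≈ 0#
  coeff-*L-< u@(lau e s) v@(lau e′ t) {A} {B} {k} u↓ v↓ k<A+B with position (e ℤ.+ e′) k
  ... | below k<e+e′ = reflexive (coeff-<-shift (u *L v) k<e+e′)
  ... | at n = trans (reflexive (coeff-shift-+ (u *L v) n)) (sumTo-zero n term≈0)
    where
    term≈0 : ∀ i → i ≤ n → s i * t (n ∸ i) ≈ 0#
    term≈0 i i≤n with (e ℤ.+ + i) ℤP.<? A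
    ... | yes e+i<A = trans (*-congʳ (trans (reflexive (≡.sym (coeff-shift-+ u i))) (u↓ _ e+i<A))) (zeroˡ _)
    ... | no  e+i≮A = trans (*-congˡ (trans (reflexive (≡.sym (coeff-shift-+ v (n ∸ i)))) (v↓ _ e′+[n-i]<B)))
                            (zeroʳ _)
      where
      indices : (e ℤ.+ + i) ℤ.+ (e′ ℤ.+ + (n ∸ i)) ≡ e ℤ.+ e′ ℤ.+ + n
      indices = ≡.trans (regroup e e′ i (n ∸ i)) (≡.cong (λ m → e ℤ.+ e′ ℤ.+ + m) (ℕP.m+[n∸m]≡n i≤n))
      e′+[n-i]<B : e′ ℤ.+ + (n ∸ i) ℤ.< B
      e′+[n-i]<B = +-<⇒< (≡.subst (ℤ._< A ℤ.+ B) (≡.sym indices) k<A+B) (ℤP.≮⇒≥ e+i≮A)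

  coeff-*L-leading : ∀ u v {A B} → (∀ k → k ℤ.< A → coeff u k ≈ 0#) → (∀ k → k ℤ.< B → coeff v k ≈ 0#) →
                     coeff (u *L v) (A ℤ.+ B) ≈ coeff u A * coeff v B
  coeff-*L-leading u@(lau e s) v@(lau e′ t) {A} {B} u↓ v↓ with position e A | position e′ B
  ... | below A<e | _ = begin
    coeff (u *L v) (A ℤ.+ B)  ≈⟨ coeff-*L-< u v (λ _ → reflexive ∘ coeff-<-shift u) v↓ (ℤP.+-monoˡ-< B A<e) ⟩
    0#                        ≈⟨ zeroˡ _ ⟨
    0# * coeff v B            ≡⟨ ≡.cong (_* coeff v B) (coeff-<-shift u A<e) ⟨
    coeff u A * coeff v B     ∎
  ... | at j | below B<e′ = begin
    coeff (u *L v) (A ℤ.+ B)  ≈⟨ coeff-*L-< u v u↓ (λ _ → reflexive ∘ coeff-<-shift v) (ℤP.+-monoʳ-< A B<e′) ⟩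
    0#                        ≈⟨ zeroʳ _ ⟨
    coeff u A * 0#            ≡⟨ ≡.cong (coeff u A *_) (coeff-<-shift v B<e′) ⟨
    coeff u A * coeff v B     ∎
  ... | at j | at j′ = begin
    coeff (u *L v) ((e ℤ.+ + j) ℤ.+ (e′ ℤ.+ + j′))    ≡⟨ ≡.cong (coeff (u *L v)) (regroup e e′ j j′) ⟩
    coeff (u *L v) (e ℤ.+ e′ ℤ.+ + (j ℕ.+ j′))        ≡⟨ coeff-shift-+ (u *L v) (j ℕ.+ j′) ⟩
    sumTo (λ i → s i * t (j ℕ.+ j′ ∸ i)) (j ℕ.+ j′)   ≈⟨ sumTo-single (j ℕ.+ j′) (ℕP.m≤m+n j j′) off-diagonal ⟩
    s j * t (j ℕ.+ j′ ∸ j)                            ≡⟨ ≡.cong (λ m → s j * t m) (ℕP.m+n∸m≡n j j′) ⟩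
    s j * t j′                                        ≡⟨ ≡.cong₂ _*_ (coeff-shift-+ u j) (coeff-shift-+ v j′) ⟨
    coeff u (e ℤ.+ + j) * coeff v (e′ ℤ.+ + j′)       ∎
    where
    off-diagonal : ∀ i → i ≤ j ℕ.+ j′ → i ≢ j → s i * t (j ℕ.+ j′ ∸ i) ≈ 0#
    off-diagonal i i≤n i≢j with ℕP.<-cmp i j
    ... | tri≈ _ i≡j _ = contradiction i≡j i≢j
    ... | tri< i<j _ _ = trans (*-congʳ (trans (reflexive (≡.sym (coeff-shift-+ u i)))
                                                (u↓ _ (ℤP.+-monoʳ-< e (+<+ i<j)))))
                               (zeroˡ _)
    ... | tri> _ _ j<i = trans (*-congˡ (trans (reflexive (≡.sym (coeff-shift-+ v (j ℕ.+ j′ ∸ i))))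
                                                (v↓ _ (ℤP.+-monoʳ-< e′ (+<+ n-i<j′)))))
                               (zeroʳ _)
      where
      n-i<j′ : j ℕ.+ j′ ∸ i < j′
      n-i<j′ = ≡.subst (j ℕ.+ j′ ∸ i <_) (ℕP.m+n∸m≡n j j′) (ℕP.∸-monoʳ-< j<i i≤n)

  lau-≈L : ∀ {e s} u → (∀ n → s n ≈ coeff u (e ℤ.+ + n)) → (∀ k → k ℤ.< e → coeff u k ≈ 0#) → lau e s ≈L u
  lau-≈L {e} {s} u s≈u u↓ k with position e k
  ... | below k<e = trans (reflexive (coeff-<-shift (lau e s) k<e)) (sym (u↓ k k<e))
  ... | at n      = trans (reflexive (coeff-shift-+ (lau e s) n)) (s≈u n)

  -- Only the coefficient of T^(2d) of the equation is used; d ≥ 1 keeps the constant b out of it.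
  monic-root-leading-idempotent : ∀ {d} → 1 ≤ d → (a : Vec Carrier d) (b : Carrier) (f : Lau) →
    f *L f ≈L monic d a *L f +L const b → (∀ k → k ℤ.< ℤ.- + d → coeff f k ≈ 0#) →
    coeff f (ℤ.- + d) * coeff f (ℤ.- + d) ≈ coeff f (ℤ.- + d)
  monic-root-leading-idempotent {suc d} _ a b f f²≈af+b f↓ = begin
    lead * lead                                          ≈⟨ coeff-*L-leading f f f↓ f↓ ⟨
    coeff (f *L f) K                                     ≈⟨ f²≈af+b K ⟩
    coeff (monic (suc d) a *L f +L const b) K            ≈⟨ coeff-+L (monic (suc d) a *L f) (const b) K ⟩
    coeff (monic (suc d) a *L f) K + coeff (const b) K   ≈⟨ +-cong (coeff-*L-leading (monic (suc d) a) f
                                                                       (λ _ → coeff-monic-< (suc d) a) f↓)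
                                                                   (reflexive (coeff-monoX-≢ b {+ 0} {K} (λ ()))) ⟩
    coeff (monic (suc d) a) -d * lead + 0#               ≈⟨ +-identityʳ _ ⟩
    coeff (monic (suc d) a) -d * lead                    ≈⟨ *-congʳ (coeff-monic-leading (suc d) a) ⟩
    1# * lead                                            ≈⟨ *-identityˡ lead ⟩
    lead                                                 ∎
    where
    -d K : ℤ
    -d = ℤ.- + suc d
    K = -d ℤ.+ -d
    lead : Carrier
    lead = coeff f -d

module PowerSeries (R : CommutativeRing 0ℓ 0ℓ) where
  open CommutativeRing R hiding (zero)
  open Laurent R using (Lau; lau; 1L; _*L_; _^L_; sumTo)
  open SumTo R using (sumTo-cong; sumTo-shift-head)
  open import Algebra.Properties.Semiring.Mult semiring using (_×_; ×-congʳ; ×-assoc-*)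
  open import Algebra.Properties.CommutativeSemigroup +-commutativeSemigroup using (xy∙z≈zy∙x)
  open import Relation.Binary.Reasoning.Setoid setoid

  Series : Set
  Series = ℕ → Carrier

  infixl 7 _⋆_
  _⋆_ : Series → Series → Series
  (s ⋆ t) n = sumTo (λ i → s i * t (n ∸ i)) n

  _⋆^_ : Series → ℕ → Series
  s ⋆^ zero  = Lau.coeffs 1L
  s ⋆^ suc k = s ⋆ (s ⋆^ k)

  lau-^L : ∀ s k → lau -[1+ 0 ] s ^L k ≡ lau (ℤ.- + k) (s ⋆^ k)
  lau-^L s zero    = ≡.refl
  lau-^L s (suc k) = ≡.trans (≡.cong (lau -[1+ 0 ] s *L_) (lau-^L s k)) (≡.cong (λ e → lau e (s ⋆^ suc k)) (-1-k k))
    where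
    -1-k : ∀ k → -[1+ 0 ] ℤ.+ ℤ.- + k ≡ ℤ.- + suc k
    -1-k zero    = ≡.refl
    -1-k (suc k) = ≡.refl

  ⋆^-local : ∀ k m {c c′ : Series} → (∀ i → i ≤ m → c i ≈ c′ i) → (c ⋆^ k) m ≈ (c′ ⋆^ k) m
  ⋆^-local zero    m _    = refl
  ⋆^-local (suc k) m c≈c′ = sumTo-cong m λ i i≤m →
    *-cong (c≈c′ i i≤m) (⋆^-local k (m ∸ i) (λ j j≤m-i → c≈c′ j (ℕP.≤-trans j≤m-i (ℕP.m∸n≤m m i))))

  ⋆^-at-0 : ∀ k {c : Series} → c 0 ≈ 1# → (c ⋆^ k) 0 ≈ 1#
  ⋆^-at-0 zero    _    = refl
  ⋆^-at-0 (suc k) c₀≈1 = trans (*-cong c₀≈1 (⋆^-at-0 k c₀≈1)) (*-identityˡ 1#)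

  infixl 9 _[_≔_]
  _[_≔_] : Series → ℕ → Carrier → Series
  (c [ N ≔ v ]) i with i ℕP.≟ N
  ... | yes _ = v
  ... | no  _ = c i

  set-≡ : ∀ c N v → (c [ N ≔ v ]) N ≡ v
  set-≡ c N v with N ℕP.≟ N
  ... | yes _   = ≡.refl
  ... | no  N≢N = contradiction ≡.refl N≢N

  set-≢ : ∀ c N v {i} → i ≢ N → (c [ N ≔ v ]) i ≡ c i
  set-≢ c N v {i} i≢N with i ℕP.≟ N
  ... | yes i≡N = contradiction i≡N i≢N
  ... | no  _   = ≡.refl

  -- With c₀ = 1, the coefficient c_N enters (c ⋆^ k)_N only through the term k c₀^(k-1) c_N.
  ⋆^-set : ∀ k {c : Series} {N} v → c 0 ≈ 1# → c (suc N) ≈ 0# →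
           ((c [ suc N ≔ v ]) ⋆^ k) (suc N) ≈ k × v + (c ⋆^ k) (suc N)
  ⋆^-set zero    v _ _ = sym (+-identityˡ 0#)
  ⋆^-set (suc k) {c} {N} v c₀≈1 c[1+N]≈0 = begin
    sumTo T⁺ N + T⁺ (suc N)                ≈⟨ +-cong (sumTo-shift-head N (k × v) head middle) last⁺ ⟩
    sumTo T N + k × v + v                  ≈⟨ xy∙z≈zy∙x _ (k × v) v ⟩
    v + k × v + sumTo T N                  ≈⟨ +-congˡ (+-identityʳ _) ⟨
    v + k × v + (sumTo T N + 0#)           ≈⟨ +-congˡ (+-congˡ last) ⟨
    v + k × v + (sumTo T N + T (suc N))    ∎
    where
    c⁺ : Series
    c⁺ = c [ suc N ≔ v ]
    T⁺ T : Series
    T⁺ i = c⁺ i * (c⁺ ⋆^ k) (suc N ∸ i)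
    T  i = c i * (c ⋆^ k) (suc N ∸ i)
    c⁺≡c : ∀ {i} → i < suc N → c⁺ i ≡ c i
    c⁺≡c i<1+N = set-≢ c (suc N) v (ℕP.<⇒≢ i<1+N)
    c⁺₀≈1 : c⁺ 0 ≈ 1#
    c⁺₀≈1 = trans (reflexive (c⁺≡c (s≤s z≤n))) c₀≈1
    head : T⁺ 0 ≈ T 0 + k × v
    head = begin
      c⁺ 0 * (c⁺ ⋆^ k) (suc N)                 ≈⟨ *-cong c⁺₀≈1 (⋆^-set k v c₀≈1 c[1+N]≈0) ⟩
      1# * (k × v + (c ⋆^ k) (suc N))          ≈⟨ *-identityˡ _ ⟩
      k × v + (c ⋆^ k) (suc N)                 ≈⟨ +-comm _ _ ⟩
      (c ⋆^ k) (suc N) + k × v                 ≈⟨ +-congʳ (*-identityˡ _) ⟨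
      1# * (c ⋆^ k) (suc N) + k × v            ≈⟨ +-congʳ (*-congʳ c₀≈1) ⟨
      T 0 + k × v                              ∎
    middle : ∀ i → 1 ≤ i → i ≤ N → T⁺ i ≈ T i
    middle i (s≤s _) i≤N = *-cong (reflexive (c⁺≡c (s≤s i≤N)))
      (⋆^-local k (suc N ∸ i) λ j j≤ → reflexive (c⁺≡c (ℕP.≤-<-trans j≤ (ℕP.∸-monoʳ-< (s≤s z≤n) (ℕP.m≤n⇒m≤1+n i≤N)))))
    last⁺ : T⁺ (suc N) ≈ v
    last⁺ = begin
      c⁺ (suc N) * (c⁺ ⋆^ k) (N ∸ N)     ≡⟨ ≡.cong₂ (λ x m → x * (c⁺ ⋆^ k) m) (set-≡ c (suc N) v) (ℕP.n∸n≡0 N) ⟩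
      v * (c⁺ ⋆^ k) 0                     ≈⟨ *-congˡ (⋆^-at-0 k c⁺₀≈1) ⟩
      v * 1#                              ≈⟨ *-identityʳ v ⟩
      v                                   ∎
    last : T (suc N) ≈ 0#
    last = trans (*-congʳ c[1+N]≈0) (zeroˡ _)

  private
    module Root {d : ℕ} (d⁻¹ : Carrier) (d×1*d⁻¹≈1 : d × 1# * d⁻¹ ≈ 1#) (h : Series) (h₀≈1 : h 0 ≈ 1#) where

      -- approx n is the root truncated at degree n; its next coefficient solves the linear equation of ⋆^-set.
      approx : ℕ → Series
      next : ℕ → Carrier

      approx zero    = Lau.coeffs 1L
      approx (suc n) = approx n [ suc n ≔ next n ]

      next n = d⁻¹ * (h (suc n) - (approx n ⋆^ d) (suc n))

      root : Series
      root n = approx n n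

      approx-0 : ∀ n → approx n 0 ≡ 1#
      approx-0 zero    = ≡.refl
      approx-0 (suc n) = ≡.trans (set-≢ (approx n) (suc n) (next n) (λ ())) (approx-0 n)

      approx-> : ∀ n {i} → n < i → approx n i ≡ 0#
      approx-> zero    {suc _} _   = ≡.refl
      approx-> (suc n) {i}     n<i =
        ≡.trans (set-≢ (approx n) (suc n) (next n) (ℕP.>⇒≢ n<i)) (approx-> n (ℕP.<-trans (ℕP.n<1+n n) n<i))

      approx-≤ : ∀ n {i} → i ≤ n → approx n i ≡ root i
      approx-≤ n {i} i≤n with i ℕP.≟ n
      approx-≤ n       i≤n | yes ≡.refl = ≡.refl
      approx-≤ zero    z≤n | no 0≢0 = contradiction ≡.refl 0≢0
      approx-≤ (suc n) i≤1+n | no i≢1+n =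
        ≡.trans (set-≢ (approx n) (suc n) (next n) i≢1+n) (approx-≤ n (ℕP.≤-pred (ℕP.≤∧≢⇒< i≤1+n i≢1+n)))

      d×d⁻¹* : ∀ w → d × (d⁻¹ * w) ≈ w
      d×d⁻¹* w = begin
        d × (d⁻¹ * w)             ≈⟨ ×-congʳ d (*-identityˡ _) ⟨
        d × (1# * (d⁻¹ * w))      ≈⟨ ×-assoc-* d 1# _ ⟨
        d × 1# * (d⁻¹ * w)        ≈⟨ *-assoc _ _ _ ⟨
        d × 1# * d⁻¹ * w          ≈⟨ *-congʳ d×1*d⁻¹≈1 ⟩
        1# * w                    ≈⟨ *-identityˡ w ⟩
        w                         ∎

      root-⋆^ : ∀ N → (root ⋆^ d) N ≈ h N
      root-⋆^ zero    = trans (⋆^-at-0 d refl) (sym h₀≈1)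
      root-⋆^ (suc n) = begin
        (root ⋆^ d) (suc n)                          ≈⟨ ⋆^-local d (suc n) (λ i i≤ → reflexive (≡.sym (approx-≤ (suc n) i≤))) ⟩
        (approx (suc n) ⋆^ d) (suc n)                ≈⟨ ⋆^-set d (next n) (reflexive (approx-0 n)) (reflexive (approx-> n ℕP.≤-refl)) ⟩
        d × (d⁻¹ * (h (suc n) - P)) + P              ≈⟨ +-congʳ (d×d⁻¹* _) ⟩
        h (suc n) - P + P                            ≈⟨ +-assoc _ _ _ ⟩
        h (suc n) + (- P + P)                        ≈⟨ +-congˡ (-‿inverseˡ P) ⟩
        h (suc n) + 0#                               ≈⟨ +-identityʳ _ ⟩
        h (suc n)                                    ∎
        where
        P : Carrier
        P = (approx n ⋆^ d) (suc n)

  ⋆^-root : ∀ d → Σ Carrier (λ y → d × 1# * y ≈ 1#) → (h : Series) → h 0 ≈ 1# →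
            Σ Series (λ c → ∀ N → (c ⋆^ d) N ≈ h N)
  ⋆^-root d (d⁻¹ , d×1*d⁻¹≈1) h h₀≈1 = root , root-⋆^
    where open Root {d} d⁻¹ d×1*d⁻¹≈1 h h₀≈1

lemma1 : {q p : ℕ} (F : FiniteField q p) →
    let open CommutativeRing (FiniteField.ring F)
        open Laurent (FiniteField.ring F)
    in (d : ℕ) → 1 ≤ d → (a : Vec Carrier d) → (b : Carrier) → ¬ (b ≈ 0#) →
       (f : Lau) →
       f *L f ≈L monic d a *L f +L const b →
       HasAbs f (+ d) →
       Coprime d p →
       Σ Lau (λ g → g ^L d ≈L f)
lemma1 F d 1≤d a b _ f f²≈af+b (lead≉0 , f↓) d⊥p = lau -[1+ 0 ] c , g^d≈f
  where
  open FiniteField F using (inv) renaming (ring to R)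
  open CommutativeRing R
  open Laurent R
  open LaurentCoefficients R using (lau-≈L; monic-root-leading-idempotent)
  open PowerSeries R using (Series; _⋆^_; ⋆^-root; lau-^L)

  lead≈1 : coeff f (ℤ.- + d) ≈ 1#
  lead≈1 = idempotent∧invertible⇒≈ε *-monoid (monic-root-leading-idempotent 1≤d a b f f²≈af+b f↓)
                                              (proj₂ (inv _ lead≉0))

  u : Series
  u n = coeff f (ℤ.- + d ℤ.+ + n)

  u₀≈1 : u 0 ≈ 1#
  u₀≈1 = trans (reflexive (≡.cong (coeff f) (ℤP.+-identityʳ (ℤ.- + d)))) lead≈1

  root : Σ Series (λ c → ∀ N → (c ⋆^ d) N ≈ u N)
  root = ⋆^-root d (×1-invertible F d⊥p) u u₀≈1

  c : Series
  c = proj₁ root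

  g^d≈f : lau -[1+ 0 ] c ^L d ≈L f
  g^d≈f = ≡.subst (_≈L f) (≡.sym (lau-^L c d)) (lau-≈L f (proj₂ root) f↓)
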